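{- Let $P$ be a pcd-lattice and $R$ an interpolative binary set-relation on $P$ with $R\subseteq\prec$. Then the relation $\lhd_R$ on $P$ defined inductively as the least relation containing $R$ and closed under conditions (1)–(5) below is a strong inclusion on $P$.
   Context: Framework: constructive set theory CZF + RRS-$\bigcup$REA (intuitionistic logic, no Powerset, Restricted Separation only; sets inductively defined by set-sized inductive definitions are sets). A pcd-lattice is a partial order $(P,\le)$ with $P,\le$ sets that is a pseudocomplemented distributive lattice; $y\prec x$ iff $x\vee y^*=1$. A relation $R$ is interpolative if $R(x,y)$ implies $R(x,z)$ and $R(z,y)$ for some $z\in P$. A strong inclusion on $P$ is a set-relation $\lhd$ satisfying: (1) $0\lhd0$, $1\lhd1$; (2) $x\le a\lhd b\le y\Rightarrow x\lhd y$; (3) $x\lhd a,\ x\lhd b\Rightarrow x\lhd a\wedge b$; (4) $x\lhd a,\ y\lhd a\Rightarrow x\vee y\lhd a$; (5) $a\lhd b\Rightarrow b^*\lhd a^*$; (6) $\lhd\subseteq\prec$; (7) $x\lhd y\Rightarrow x\lhd z\lhd y$ for some $z\in P$. -}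

module Defs where

open import Level using (Level; _⊔_) renaming (suc to lsuc)
open import Data.Product using (Σ; _×_; _,_)
open import Relation.Binary.Core using (Rel)
open import Algebra.Core using (Op₁; Op₂)
open import Algebra.Definitions using (_DistributesOverˡ_)
open import Relation.Binary.Lattice.Structures using (IsBoundedLattice)

record PCDLattice c ℓ₁ ℓ₂ : Set (lsuc (c ⊔ ℓ₁ ⊔ ℓ₂)) where
  infix  4 _≈_ _≤_
  infixr 6 _∨_
  infixr 7 _∧_
  infix  8 _*
  field
    Carrier          : Set c
    _≈_              : Rel Carrier ℓ₁
    _≤_              : Rel Carrier ℓ₂
    _∨_              : Op₂ Carrier
    _∧_              : Op₂ Carrier
    𝟙                : Carrier
    𝟘                : Carrier
    _*               : Op₁ Carrier
    isBoundedLattice : IsBoundedLattice _≈_ _≤_ _∨_ _∧_ 𝟙 𝟘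
    ∧-distribˡ-∨     : _DistributesOverˡ_ _≈_ _∧_ _∨_
    *-disjoint       : ∀ x → x ∧ (x *) ≈ 𝟘
    *-greatest       : ∀ x y → x ∧ y ≈ 𝟘 → y ≤ x *

  open IsBoundedLattice isBoundedLattice public

module _ {c ℓ₁ ℓ₂ : Level} (P : PCDLattice c ℓ₁ ℓ₂) where
  open PCDLattice P

  _≺_ : Rel Carrier ℓ₁
  y ≺ x = x ∨ (y *) ≈ 𝟙

  Interpolative : {ℓ : Level} → Rel Carrier ℓ → Set (c ⊔ ℓ)
  Interpolative R = ∀ {x y} → R x y → Σ Carrier (λ z → R x z × R z y)

  -- Strong inclusion: conditions (1)–(7)
  record IsStrongInclusion {ℓ : Level} (_◁_ : Rel Carrier ℓ)
         : Set (c ⊔ ℓ₁ ⊔ ℓ₂ ⊔ ℓ) where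
    field
      si-0     : 𝟘 ◁ 𝟘
      si-1     : 𝟙 ◁ 𝟙
      si-mono  : ∀ {x a b y} → x ≤ a → a ◁ b → b ≤ y → x ◁ y
      si-meet  : ∀ {x a b} → x ◁ a → x ◁ b → x ◁ (a ∧ b)
      si-join  : ∀ {x y a} → x ◁ a → y ◁ a → (x ∨ y) ◁ a
      si-pc    : ∀ {a b} → a ◁ b → (b *) ◁ (a *)
      si-≺     : ∀ {x y} → x ◁ y → x ≺ y
      si-interp : ∀ {x y} → x ◁ y → Σ Carrier (λ z → x ◁ z × z ◁ y)

  data ◁[_] {ℓ : Level} (R : Rel Carrier ℓ) : Rel Carrier (c ⊔ ℓ₂ ⊔ ℓ) where
    gen  : ∀ {x y} → R x y → ◁[ R ] x y
    cl-0 : ◁[ R ] 𝟘 𝟘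
    cl-1 : ◁[ R ] 𝟙 𝟙
    cl-mono : ∀ {x a b y} → x ≤ a → ◁[ R ] a b → b ≤ y → ◁[ R ] x y
    cl-meet : ∀ {x a b} → ◁[ R ] x a → ◁[ R ] x b → ◁[ R ] x (a ∧ b)
    cl-join : ∀ {x y a} → ◁[ R ] x a → ◁[ R ] y a → ◁[ R ] (x ∨ y) a
    cl-pc   : ∀ {a b} → ◁[ R ] a b → ◁[ R ] (b *) (a *)

-- Every R-related pair is ≺-related, and ≺ is itself closed under the
-- rules (1)–(5) generating ◁_R; so the least such relation lies inside ≺,
-- which is (6).  Interpolation (7) is proved by induction on the
-- derivation: a rule applied to interpolants of its premises interpolates
-- its conclusion (meets of interpolants for (3), joins for (4),
-- pseudocomplements, with the two halves swapped, for (5)).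
module Submission where

import Defs
open import Level using (Level)
open import Data.Product using (_,_)
open import Relation.Binary.Core using (Rel; _⇒_)
open import Relation.Binary.Lattice.Bundles using (DistributiveLattice)
import Relation.Binary.Lattice.Properties.DistributiveLattice as DistributiveLatticeProperties
import Relation.Binary.Lattice.Properties.JoinSemilattice as JoinSemilatticeProperties
import Relation.Binary.Lattice.Properties.MeetSemilattice as MeetSemilatticeProperties
import Relation.Binary.Reasoning.Setoid as SetoidReasoning

module PCDLatticeProperties {c ℓ₁ ℓ₂ : Level} (P : Defs.PCDLattice c ℓ₁ ℓ₂) where
  open Defs hiding (_≺_)
  open PCDLattice P

  infix 4 _≺_
  _≺_ : Rel Carrier ℓ₁
  _≺_ = Defs._≺_ P

  distributiveLattice : DistributiveLattice c ℓ₁ ℓ₂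
  distributiveLattice = record
    { isDistributiveLattice = record
      { isLattice = isLattice ; ∧-distribˡ-∨ = ∧-distribˡ-∨ } }

  open DistributiveLattice distributiveLattice
    using (setoid; joinSemilattice; meetSemilattice)
  open DistributiveLatticeProperties distributiveLattice
    using (∧-distribʳ-∨; ∨-distribˡ-∧; ∨-distribʳ-∧)
  open JoinSemilatticeProperties joinSemilattice
    using (∨-monotonic; ∨-cong; ∨-comm; ∨-idempotent)
  open MeetSemilatticeProperties meetSemilattice
    using (∧-monotonic; ∧-cong; ∧-comm; ∧-idempotent)
  open SetoidReasoning setoid

  ≤𝟘⇒≈𝟘 : ∀ {x} → x ≤ 𝟘 → x ≈ 𝟘
  ≤𝟘⇒≈𝟘 {x} x≤𝟘 = antisym x≤𝟘 (minimum x)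

  𝟙≤⇒≈𝟙 : ∀ {x} → 𝟙 ≤ x → x ≈ 𝟙
  𝟙≤⇒≈𝟙 {x} 𝟙≤x = antisym (maximum x) 𝟙≤x

  ∨≈𝟙-mono : ∀ {a a′ b b′} → a ≤ a′ → b ≤ b′ → a ∨ b ≈ 𝟙 → a′ ∨ b′ ≈ 𝟙
  ∨≈𝟙-mono a≤a′ b≤b′ a∨b≈𝟙 =
    𝟙≤⇒≈𝟙 (trans (reflexive (Eq.sym a∨b≈𝟙)) (∨-monotonic a≤a′ b≤b′))

  *-antitone : ∀ {x y} → x ≤ y → y * ≤ x *
  *-antitone {x} {y} x≤y = *-greatest x (y *)
    (≤𝟘⇒≈𝟘 (trans (∧-monotonic x≤y refl) (reflexive (*-disjoint y))))

  x≤x** : ∀ {x} → x ≤ x * *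
  x≤x** {x} = *-greatest (x *) x (Eq.trans (∧-comm (x *) x) (*-disjoint x))

  *∧*≤[∨]* : ∀ {x y} → x * ∧ y * ≤ (x ∨ y) *
  *∧*≤[∨]* {x} {y} = *-greatest (x ∨ y) (x * ∧ y *) (begin
    (x ∨ y) ∧ (x * ∧ y *)              ≈⟨ ∧-distribʳ-∨ (x * ∧ y *) x y ⟩
    x ∧ (x * ∧ y *) ∨ y ∧ (x * ∧ y *)  ≈⟨ ∨-cong (disjoint x (x∧y≤x _ _))
                                                 (disjoint y (x∧y≤y _ _)) ⟩
    𝟘 ∨ 𝟘                              ≈⟨ ∨-idempotent 𝟘 ⟩
    𝟘                                  ∎)
    where
    disjoint : ∀ u {v} → v ≤ u * → u ∧ v ≈ 𝟘
    disjoint u v≤u* = ≤𝟘⇒≈𝟘 (trans (∧-monotonic refl v≤u*) (reflexive (*-disjoint u)))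

  𝟘≺𝟘 : 𝟘 ≺ 𝟘
  𝟘≺𝟘 = 𝟙≤⇒≈𝟙 (trans 𝟙≤𝟘* (y≤x∨y 𝟘 (𝟘 *)))
    where
    𝟙≤𝟘* : 𝟙 ≤ 𝟘 *
    𝟙≤𝟘* = *-greatest 𝟘 𝟙 (≤𝟘⇒≈𝟘 (x∧y≤x 𝟘 𝟙))

  𝟙≺𝟙 : 𝟙 ≺ 𝟙
  𝟙≺𝟙 = 𝟙≤⇒≈𝟙 (x≤x∨y 𝟙 (𝟙 *))

  ≺-mono : ∀ {x a b y} → x ≤ a → a ≺ b → b ≤ y → x ≺ y
  ≺-mono x≤a a≺b b≤y = ∨≈𝟙-mono b≤y (*-antitone x≤a) a≺b

  ≺-∧ : ∀ {x a b} → x ≺ a → x ≺ b → x ≺ a ∧ b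
  ≺-∧ {x} {a} {b} x≺a x≺b = begin
    a ∧ b ∨ x *            ≈⟨ ∨-distribʳ-∧ (x *) a b ⟩
    (a ∨ x *) ∧ (b ∨ x *)  ≈⟨ ∧-cong x≺a x≺b ⟩
    𝟙 ∧ 𝟙                  ≈⟨ ∧-idempotent 𝟙 ⟩
    𝟙                      ∎

  ≺-∨ : ∀ {x y a} → x ≺ a → y ≺ a → x ∨ y ≺ a
  ≺-∨ {x} {y} {a} x≺a y≺a = ∨≈𝟙-mono refl *∧*≤[∨]* (begin
    a ∨ x * ∧ y *          ≈⟨ ∨-distribˡ-∧ a (x *) (y *) ⟩
    (a ∨ x *) ∧ (a ∨ y *)  ≈⟨ ∧-cong x≺a y≺a ⟩
    𝟙 ∧ 𝟙                  ≈⟨ ∧-idempotent 𝟙 ⟩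
    𝟙                      ∎)

  ≺-* : ∀ {a b} → a ≺ b → b * ≺ a *
  ≺-* {a} {b} a≺b = ∨≈𝟙-mono refl x≤x** (Eq.trans (∨-comm (a *) b) a≺b)

  module _ {ℓ : Level} (R : Rel Carrier ℓ) where

    ◁[]⊆≺ : R ⇒ _≺_ → ◁[_] P R ⇒ _≺_
    ◁[]⊆≺ R⊆≺ (gen r)               = R⊆≺ r
    ◁[]⊆≺ R⊆≺ cl-0                  = 𝟘≺𝟘
    ◁[]⊆≺ R⊆≺ cl-1                  = 𝟙≺𝟙
    ◁[]⊆≺ R⊆≺ (cl-mono x≤a a◁b b≤y) = ≺-mono x≤a (◁[]⊆≺ R⊆≺ a◁b) b≤y
    ◁[]⊆≺ R⊆≺ (cl-meet x◁a x◁b)     = ≺-∧ (◁[]⊆≺ R⊆≺ x◁a) (◁[]⊆≺ R⊆≺ x◁b)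
    ◁[]⊆≺ R⊆≺ (cl-join x◁a y◁a)     = ≺-∨ (◁[]⊆≺ R⊆≺ x◁a) (◁[]⊆≺ R⊆≺ y◁a)
    ◁[]⊆≺ R⊆≺ (cl-pc a◁b)           = ≺-* (◁[]⊆≺ R⊆≺ a◁b)

    ◁[]-interpolative : Interpolative P R → Interpolative P (◁[_] P R)
    ◁[]-interpolative interp (gen r) with interp r
    ... | z , xRz , zRy = z , gen xRz , gen zRy
    ◁[]-interpolative interp cl-0 = 𝟘 , cl-0 , cl-0
    ◁[]-interpolative interp cl-1 = 𝟙 , cl-1 , cl-1
    ◁[]-interpolative interp (cl-mono x≤a a◁b b≤y) with ◁[]-interpolative interp a◁b
    ... | z , a◁z , z◁b = z , cl-mono x≤a a◁z refl , cl-mono refl z◁b b≤y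
    ◁[]-interpolative interp (cl-meet x◁a x◁b)
      with ◁[]-interpolative interp x◁a | ◁[]-interpolative interp x◁b
    ... | z , x◁z , z◁a | w , x◁w , w◁b =
      z ∧ w , cl-meet x◁z x◁w ,
      cl-meet (cl-mono (x∧y≤x z w) z◁a refl) (cl-mono (x∧y≤y z w) w◁b refl)
    ◁[]-interpolative interp (cl-join x◁a y◁a)
      with ◁[]-interpolative interp x◁a | ◁[]-interpolative interp y◁a
    ... | z , x◁z , z◁a | w , y◁w , w◁a =
      z ∨ w , cl-join (cl-mono refl x◁z (x≤x∨y z w)) (cl-mono refl y◁w (y≤x∨y z w)) ,
      cl-join z◁a w◁a
    ◁[]-interpolative interp (cl-pc a◁b) with ◁[]-interpolative interp a◁b
    ... | z , a◁z , z◁b = z * , cl-pc z◁b , cl-pc a◁z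

open Defs
open PCDLatticeProperties using (◁[]⊆≺; ◁[]-interpolative)

lemma4p1 : {c ℓ₁ ℓ₂ ℓ : Level} (P : PCDLattice c ℓ₁ ℓ₂)
           (R : Rel (PCDLattice.Carrier P) ℓ) →
           Interpolative P R →
           (∀ {x y} → R x y → _≺_ P x y) →
           IsStrongInclusion P (◁[_] P R)
lemma4p1 P R interp R⊆≺ = record
  { si-0      = cl-0
  ; si-1      = cl-1
  ; si-mono   = cl-mono
  ; si-meet   = cl-meet
  ; si-join   = cl-join
  ; si-pc     = cl-pc
  ; si-≺      = ◁[]⊆≺ P R R⊆≺
  ; si-interp = ◁[]-interpolative P R interp
  }
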